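{- Let $q$ be a power of an odd prime and let $aX^{q^2}+bX^q+cX\in\mathbb{F}_q[X]$ be a polynomial with no roots in $\mathbb{F}_{q^3}^*$. Define $$\alpha=abc,\quad \beta=a^2b+ac^2+b^2c,\quad \gamma=a^2c+ab^2+bc^2,\quad \delta=a^3+b^3+c^3+3abc.$$ If the system $$\begin{cases} -A^2D+ABE-B^2C=2\alpha\\ A^2C-ABD-2ACD+2AE^2+B^2E-2BCE+2BD^2=2\beta\\ A^2E-ABC+2AC^2-2ADE+B^2D-2BCD+2BE^2=2\gamma\\ A^3+B^3+4C^3-12CDE+4D^3+4E^3=2\delta \end{cases}$$ has a solution $(A,B,C,D,E)\in\mathbb{F}_q^5$, then the polynomial $$f_{E,A,B,C,D}(X)=EX^2+AX^{q+1}+BX^{q^2+1}+CX^{2q}+DX^{2q^2}$$ is planar over $\mathbb{F}_{q^3}$.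
   Context: For $q$ odd, a function $f:\mathbb{F}_{q^n}\to\mathbb{F}_{q^n}$ is called planar (over $\mathbb{F}_{q^n}$) if for every $\epsilon\in\mathbb{F}_{q^n}^*$ the polynomial $f(X+\epsilon)-f(X)$ induces a permutation of $\mathbb{F}_{q^n}$. -}

module Defs where

open import Level using (Level; _⊔_) renaming (suc to lsuc)
open import Data.Nat using (ℕ)
open import Data.Product using (Σ)
open import Relation.Nullary using (¬_)
open import Algebra.Bundles using (CommutativeRing; Semiring)
import Algebra.Definitions.RawSemiring as RawSemiringDefs
open import Function.Definitions using (Bijective)

record Field (c ℓ : Level) : Set (lsuc (c ⊔ ℓ)) where
  field
    commutativeRing : CommutativeRing c ℓ
  open CommutativeRing commutativeRing public
  open RawSemiringDefs (Semiring.rawSemiring semiring) public using (_^_; _×_)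
  field
    1≉0     : ¬ (1# ≈ 0#)
    inverse : ∀ x → ¬ (x ≈ 0#) → Σ Carrier (λ y → (x * y) ≈ 1#)

module _ {c ℓ : Level} (K : Field c ℓ) where
  open Field K

  InSubfield : ℕ → Carrier → Set ℓ
  InSubfield q x = (x ^ q) ≈ x

  Planar : (Carrier → Carrier) → Set (c ⊔ ℓ)
  Planar f = ∀ ε → ¬ (ε ≈ 0#) → Bijective _≈_ _≈_ (λ x → f (x + ε) - f x)

{-# OPTIONS --safe #-}
-- Let σ x = x ^ q, a ring automorphism of K = 𝔽_{q³} of order 3 fixing a, b, c and A, …, E.
-- Then f X = Q (X, σ X, σ² X) for the quadratic form
-- Q (u₀, u₁, u₂) = E u₀² + A u₁u₀ + B u₂u₀ + C u₁² + D u₂², so f (X + ε) − f X = L_ε X + f ε with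
-- L_ε additive, and f is planar once L_ε z = 0 forces z = 0 for ε ≠ 0. Applying σ to L_ε z = 0
-- gives three linear equations in z, σ z, σ² z whose matrix is the Dickson matrix of L_ε, so
-- Cramer's rule gives det · z = 0. Expanding the determinant, the system on (A, …, E) says exactly
-- that det = 4 · N (h ε), where N is the norm to 𝔽_q and h ε = a ε^q + b ε^{q²} + c ε. This h is
-- the adjoint of g x = a x^{q²} + b x^q + c x for the trace form, Tr (e · g x) = Tr (x · h e).
-- As g has no nonzero root it is onto, so h e = 0 with e ≠ 0 would make Tr vanish on all of K,
-- which a polynomial of degree q² < q³ cannot do. Hence det ≠ 0 (p is odd) and z = 0.
module Submission where

open import Defs
open import Level using (Level; 0ℓ)
import Data.Nat
open import Data.Nat using (ℕ; zero; suc; _!) renaming (_^_ to _^ℕ_; _+_ to _+ℕ_)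
open import Data.Nat.Primality using (Prime)
open import Data.Fin using (Fin)
open import Relation.Nullary using (¬_)
open import Relation.Binary.PropositionalEquality using (_≡_; _≢_) renaming (setoid to ≡-setoid)
open import Function.Bundles using (Bijection)

open import Algebra.Bundles using (CommutativeMonoid; CommutativeRing; CommutativeSemiring; RawRing; Ring)
import Algebra.Morphism.Construct.Identity as IdentityMorphism
open import Algebra.Morphism.Structures using (module RingMorphisms)
import Algebra.Properties.CommutativeMonoid.Sum as CommutativeMonoidSum
import Algebra.Properties.CommutativeSemigroup as CommutativeSemigroupProperties
import Algebra.Properties.Semiring.Mult
import Algebra.Solver.Ring
open import Algebra.Solver.Ring.AlmostCommutativeRing using (fromCommutativeRing; _-Raw-AlmostCommutative⟶_)
open import Data.Empty using (⊥-elim)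
import Data.Fin as Fin
import Data.Fin.Properties as Fin
open import Data.Fin.Permutation using (permutation)
open import Data.Integer as ℤ using (ℤ; +_; -[1+_]; _⊖_)
import Data.Integer.Properties as ℤ
open import Data.List using (List; []; _∷_; _++_; length; replicate)
open import Data.List.Properties using (length-++; length-replicate)
open import Data.Maybe using (Maybe; just; nothing)
import Data.Nat as ℕ
import Data.Nat.Properties as ℕ
open import Data.Nat.Combinatorics using (nCn≡1; k![n∸k]!∣n!) renaming (_C_ to _choose_)
open import Data.Nat.Combinatorics.Specification using (nCk≡n!/k![n-k]!)
open import Data.Nat.DivMod using (_%_; _/_; m/n*n≡m; m%n<n; m≡m%n+[m/n]*n)
open import Data.Nat.Divisibility using (_∣_; _∤_; divides; ∣⇒≤; m∣m*n; ∣1⇒≡1)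
open import Data.Nat.Primality
  using (euclidsLemma; ¬prime[0]; ¬prime[1]; prime⇒nonZero; prime⇒nonTrivial; prime⇒irreducible)
open import Data.Product using (∃; _,_; proj₁; proj₂)
open import Data.Sign as Sign using (Sign)
open import Data.Sum using (inj₁; inj₂)
open import Data.Vec as Vec using (Vec)
open import Data.Vec.Functional using (removeAt)
open import Data.Vec.N-ary using (N-ary; _$ⁿ_)
open import Data.Vec.Relation.Binary.Pointwise.Inductive as Pointwise using (Pointwise; []; _∷_)
open import Function using (_∘_)
open import Function.Definitions using (Congruent; Injective; Surjective)
open import Relation.Binary.Definitions using (Decidable)
import Relation.Binary.PropositionalEquality as ≡
open import Relation.Nullary using (yes; no)

-- The library's ready-made instances of the ring solver need decidable equality or have no
-- negation; integer coefficients serve every commutative ring.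
module IntegerCoefficients {c ℓ} (R : CommutativeRing c ℓ) where
  open CommutativeRing R
  open import Algebra.Properties.Semiring.Mult semiring using (_×_; ×-homo-+; ×1-homo-*)
  open import Algebra.Properties.Semiring.Exp semiring using (_^_; ^-congˡ)
  open import Algebra.Properties.Ring ring
    using (-0#≈0#; -‿involutive; -‿+-comm; -‿distribˡ-*; -‿distribʳ-*)
  open CommutativeSemigroupProperties +-commutativeSemigroup using (interchange)
  open import Relation.Binary.Reasoning.Setoid setoid

  fromℤ : ℤ → Carrier
  fromℤ (+ n)    = n × 1#
  fromℤ -[1+ n ] = - (suc n × 1#)

  fromℤ-neg : ∀ i → fromℤ (ℤ.- i) ≈ - fromℤ i
  fromℤ-neg (+ zero)  = sym -0#≈0#
  fromℤ-neg (+ suc n) = refl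
  fromℤ-neg -[1+ n ]  = sym (-‿involutive _)

  fromℤ-⊖ : ∀ m n → fromℤ (m ⊖ n) ≈ m × 1# - n × 1#
  fromℤ-⊖ zero    zero    = sym (-‿inverseʳ 0#)
  fromℤ-⊖ zero    (suc n) = sym (+-identityˡ _)
  fromℤ-⊖ (suc m) zero    = sym (trans (+-congˡ -0#≈0#) (+-identityʳ _))
  fromℤ-⊖ (suc m) (suc n) = begin
    fromℤ (suc m ⊖ suc n)           ≡⟨ ≡.cong fromℤ (ℤ.[1+m]⊖[1+n]≡m⊖n m n) ⟩
    fromℤ (m ⊖ n)                   ≈⟨ fromℤ-⊖ m n ⟩
    m × 1# - n × 1#                 ≈⟨ +-identityˡ _ ⟨
    0# + (m × 1# - n × 1#)          ≈⟨ +-congʳ (-‿inverseʳ 1#) ⟨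
    (1# - 1#) + (m × 1# - n × 1#)   ≈⟨ interchange 1# (- 1#) (m × 1#) (- (n × 1#)) ⟩
    (1# + m × 1#) + (- 1# - n × 1#) ≈⟨ +-congˡ (-‿+-comm 1# (n × 1#)) ⟩
    (1# + m × 1#) - (1# + n × 1#)   ∎

  fromℤ-+ : ∀ i j → fromℤ (i ℤ.+ j) ≈ fromℤ i + fromℤ j
  fromℤ-+ (+ m)    (+ n)    = ×-homo-+ 1# m n
  fromℤ-+ (+ m)    -[1+ n ] = fromℤ-⊖ m (suc n)
  fromℤ-+ -[1+ m ] (+ n)    = trans (fromℤ-⊖ n (suc m)) (+-comm _ _)
  fromℤ-+ -[1+ m ] -[1+ n ] = begin
    - (suc (suc (m ℕ.+ n)) × 1#)    ≡⟨ ≡.cong (λ k → - (k × 1#)) (ℕ.+-suc (suc m) n) ⟨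
    - ((suc m ℕ.+ suc n) × 1#)      ≈⟨ -‿cong (×-homo-+ 1# (suc m) (suc n)) ⟩
    - (suc m × 1# + suc n × 1#)     ≈⟨ -‿+-comm _ _ ⟨
    - (suc m × 1#) + - (suc n × 1#) ∎

  signed : Sign → Carrier → Carrier
  signed Sign.+ x = x
  signed Sign.- x = - x

  fromℤ-◃ : ∀ s n → fromℤ (s ℤ.◃ n) ≈ signed s (n × 1#)
  fromℤ-◃ Sign.+ zero    = refl
  fromℤ-◃ Sign.- zero    = sym -0#≈0#
  fromℤ-◃ Sign.+ (suc n) = refl
  fromℤ-◃ Sign.- (suc n) = refl

  fromℤ-signAbs : ∀ i → fromℤ i ≈ signed (ℤ.sign i) (ℤ.∣ i ∣ × 1#)
  fromℤ-signAbs (+ zero)  = refl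
  fromℤ-signAbs (+ suc n) = refl
  fromℤ-signAbs -[1+ n ]  = refl

  signed-cong : ∀ s {x y} → x ≈ y → signed s x ≈ signed s y
  signed-cong Sign.+ x≈y = x≈y
  signed-cong Sign.- x≈y = -‿cong x≈y

  signed-* : ∀ s t x y → signed (s Sign.* t) (x * y) ≈ signed s x * signed t y
  signed-* Sign.+ Sign.+ x y = refl
  signed-* Sign.+ Sign.- x y = -‿distribʳ-* x y
  signed-* Sign.- Sign.+ x y = -‿distribˡ-* x y
  signed-* Sign.- Sign.- x y = begin
    x * y       ≈⟨ -‿involutive _ ⟨
    - - (x * y) ≈⟨ -‿cong (-‿distribʳ-* x y) ⟩
    - (x * - y) ≈⟨ -‿distribˡ-* x (- y) ⟩
    - x * - y   ∎

  fromℤ-* : ∀ i j → fromℤ (i ℤ.* j) ≈ fromℤ i * fromℤ j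
  fromℤ-* i j = begin
    fromℤ (i ℤ.* j)                         ≈⟨ fromℤ-◃ (s Sign.* t) (m ℕ.* n) ⟩
    signed (s Sign.* t) ((m ℕ.* n) × 1#)     ≈⟨ signed-cong (s Sign.* t) (×1-homo-* m n) ⟩
    signed (s Sign.* t) ((m × 1#) * (n × 1#)) ≈⟨ signed-* s t _ _ ⟩
    signed s (m × 1#) * signed t (n × 1#)   ≈⟨ *-cong (fromℤ-signAbs i) (fromℤ-signAbs j) ⟨
    fromℤ i * fromℤ j                       ∎
    where
    s = ℤ.sign i
    t = ℤ.sign j
    m = ℤ.∣ i ∣
    n = ℤ.∣ j ∣

  fromℤ-morphism : ℤ.+-*-rawRing -Raw-AlmostCommutative⟶ fromCommutativeRing R
  fromℤ-morphism = record
    { ⟦_⟧    = fromℤ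
    ; +-homo = fromℤ-+
    ; *-homo = fromℤ-*
    ; -‿homo = fromℤ-neg
    ; 0-homo = refl
    ; 1-homo = +-identityʳ 1#
    }

  fromℤ-≟ : ∀ i j → Maybe (fromℤ i ≈ fromℤ j)
  fromℤ-≟ i j with i ℤ.≟ j
  ... | yes ≡.refl = just refl
  ... | no _       = nothing

  open Algebra.Solver.Ring ℤ.+-*-rawRing (fromCommutativeRing R) fromℤ-morphism fromℤ-≟ public

  close : ∀ {a} {A : Set a} n → N-ary n (Polynomial n) A → A
  close n f = f $ⁿ Vec.map var (Vec.allFin n)

  polynomialRawRing : ℕ → RawRing 0ℓ 0ℓ
  polynomialRawRing n = record
    { Carrier = Polynomial n
    ; _≈_     = _≡_
    ; _+_     = _:+_
    ; _*_     = _:*_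
    ; -_      = :-_
    ; 0#      = con (+ 0)
    ; 1#      = con (+ 1)
    }

  module _ {σ : Carrier → Carrier}
           (σ-isRingHomomorphism : RingMorphisms.IsRingHomomorphism rawRing rawRing σ) where
    open RingMorphisms.IsRingHomomorphism σ-isRingHomomorphism

    σ-× : ∀ n → σ (n × 1#) ≈ n × 1#
    σ-× zero    = 0#-homo
    σ-× (suc n) = trans (+-homo 1# (n × 1#)) (+-cong 1#-homo (σ-× n))

    σ-fromℤ : ∀ i → σ (fromℤ i) ≈ fromℤ i
    σ-fromℤ (+ n)    = σ-× n
    σ-fromℤ -[1+ n ] = trans (-‿homo _) (-‿cong (σ-× (suc n)))

    σ-^ : ∀ x n → σ (x ^ n) ≈ σ x ^ n
    σ-^ x zero    = 1#-homo
    σ-^ x (suc n) = trans (*-homo x (x ^ n)) (*-congˡ (σ-^ x n))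

    ⟦⟧-homo : ∀ {n} (p : Polynomial n) {ρ ρ′ : Vec Carrier n} →
              Pointwise (λ x y → σ x ≈ y) ρ ρ′ → σ (⟦ p ⟧ ρ) ≈ ⟦ p ⟧ ρ′
    ⟦⟧-homo (op [+] p q) σρ≈ρ′ = trans (+-homo _ _) (+-cong (⟦⟧-homo p σρ≈ρ′) (⟦⟧-homo q σρ≈ρ′))
    ⟦⟧-homo (op [*] p q) σρ≈ρ′ = trans (*-homo _ _) (*-cong (⟦⟧-homo p σρ≈ρ′) (⟦⟧-homo q σρ≈ρ′))
    ⟦⟧-homo (con i)      σρ≈ρ′ = σ-fromℤ i
    ⟦⟧-homo (var x)      σρ≈ρ′ = Pointwise.lookup σρ≈ρ′ x
    ⟦⟧-homo (p :^ n)     σρ≈ρ′ = trans (σ-^ _ n) (^-congˡ n (⟦⟧-homo p σρ≈ρ′))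
    ⟦⟧-homo (:- p)       σρ≈ρ′ = trans (-‿homo _) (-‿cong (⟦⟧-homo p σρ≈ρ′))

  ⟦⟧-cong : ∀ {n} (p : Polynomial n) {ρ ρ′ : Vec Carrier n} →
            Pointwise _≈_ ρ ρ′ → ⟦ p ⟧ ρ ≈ ⟦ p ⟧ ρ′
  ⟦⟧-cong = ⟦⟧-homo (IdentityMorphism.isRingHomomorphism rawRing refl)

module _ {m ℓm} (M : CommutativeMonoid m ℓm) where
  open CommutativeMonoid M
  open CommutativeMonoidSum M using (sum; sum-remove; sum-cong-≋; sum-replicate-zero)

  sum-single : ∀ {n} (f : Fin n → Carrier) i → (∀ j → j ≢ i → f j ≈ ε) → sum f ≈ f i
  sum-single {suc n} f i f≈ε = begin
    sum f                        ≈⟨ sum-remove {i = i} f ⟩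
    f i ∙ sum (removeAt f i)     ≈⟨ ∙-congˡ (sum-cong-≋ {n} {removeAt f i} {λ _ → ε}
                                      λ j → f≈ε (Fin.punchIn i j) (Fin.punchInᵢ≢i i j)) ⟩
    f i ∙ sum {n} (λ _ → ε)      ≈⟨ ∙-congˡ (sum-replicate-zero n) ⟩
    f i ∙ ε                      ≈⟨ identityʳ (f i) ⟩
    f i                          ∎
    where open import Relation.Binary.Reasoning.Setoid setoid

-- A value j missed by h would extend h to an injection Fin (suc n) → Fin n.
Fin-injective⇒surjective : ∀ {n} (h : Fin n → Fin n) → Injective ≡._≡_ ≡._≡_ h →
                           ∀ j → ∃ λ i → h i ≡ j
Fin-injective⇒surjective {n} h h-injective j with Fin.any? (λ i → h i Fin.≟ j)
... | yes hit = hit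
... | no miss = ⊥-elim (ℕ.<-irrefl ≡.refl (Fin.injective⇒≤ {f = extend} extend-injective))
  where
  extend : Fin (suc n) → Fin n
  extend Fin.zero    = j
  extend (Fin.suc i) = h i
  extend-injective : Injective ≡._≡_ ≡._≡_ extend
  extend-injective {Fin.zero}  {Fin.zero}  _  = ≡.refl
  extend-injective {Fin.zero}  {Fin.suc i} eq = ⊥-elim (miss (i , ≡.sym eq))
  extend-injective {Fin.suc i} {Fin.zero}  eq = ⊥-elim (miss (i , eq))
  extend-injective {Fin.suc i} {Fin.suc k} eq = ≡.cong Fin.suc (h-injective eq)

module FieldProperties {c ℓ} (K : Field c ℓ) where
  open Field K
  open import Algebra.Properties.Ring ring using (x∙y⁻¹≈ε⇒x≈y)
  open import Relation.Binary.Reasoning.Setoid setoid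

  x≉0∧xy≈0⇒y≈0 : ∀ {x y} → x ≉ 0# → x * y ≈ 0# → y ≈ 0#
  x≉0∧xy≈0⇒y≈0 {x} {y} x≉0 xy≈0 = begin
    y             ≈⟨ *-identityˡ y ⟨
    1# * y        ≈⟨ *-congʳ (trans (*-comm _ _) x⁻¹x≈1) ⟨
    (x⁻¹ * x) * y ≈⟨ *-assoc x⁻¹ x y ⟩
    x⁻¹ * (x * y) ≈⟨ *-congˡ xy≈0 ⟩
    x⁻¹ * 0#      ≈⟨ zeroʳ x⁻¹ ⟩
    0#            ∎
    where
    x⁻¹ = proj₁ (inverse x x≉0)
    x⁻¹x≈1 = proj₂ (inverse x x≉0)

  x≉0∧y≉0⇒xy≉0 : ∀ {x y} → x ≉ 0# → y ≉ 0# → x * y ≉ 0#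
  x≉0∧y≉0⇒xy≉0 x≉0 y≉0 xy≈0 = y≉0 (x≉0∧xy≈0⇒y≈0 x≉0 xy≈0)

  *-cancelʳ-≉0 : ∀ {x y z} → z ≉ 0# → x * z ≈ y * z → x ≈ y
  *-cancelʳ-≉0 {x} {y} {z} z≉0 xz≈yz = x∙y⁻¹≈ε⇒x≈y x y (x≉0∧xy≈0⇒y≈0 z≉0 (begin
    z * (x - y)     ≈⟨ *-comm z (x - y) ⟩
    (x - y) * z     ≈⟨ [y-z]x≈yx-zx z x y ⟩
    x * z - y * z   ≈⟨ +-congʳ xz≈yz ⟩
    y * z - y * z   ≈⟨ -‿inverseʳ (y * z) ⟩
    0#              ∎))
    where open import Algebra.Properties.Ring ring using ([y-z]x≈yx-zx)

  Planar-cong : ∀ {f g} → (∀ x → f x ≈ g x) → Planar K f → Planar K g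
  Planar-cong {f} {g} f≈g f-planar ε ε≉0 = Δg-injective , Δg-surjective
    where
    Δf≈Δg : ∀ x → f (x + ε) - f x ≈ g (x + ε) - g x
    Δf≈Δg x = +-cong (f≈g (x + ε)) (-‿cong (f≈g x))
    Δg-injective : ∀ {x y} → g (x + ε) - g x ≈ g (y + ε) - g y → x ≈ y
    Δg-injective {x} {y} Δx≈Δy = proj₁ (f-planar ε ε≉0) (trans (Δf≈Δg x) (trans Δx≈Δy (sym (Δf≈Δg y))))
    Δg-surjective : Surjective _≈_ _≈_ (λ x → g (x + ε) - g x)
    Δg-surjective y with proj₂ (f-planar ε ε≉0) y
    ... | x , Δf≈y = x , λ z≈x → trans (sym (Δf≈Δg _)) (Δf≈y z≈x)

module MonicPolynomials {c ℓ} (K : Field c ℓ) where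
  open Field K
  open FieldProperties K using (x≉0∧xy≈0⇒y≈0)
  open IntegerCoefficients commutativeRing using (solve; _:=_; _:+_; _:*_; _:-_)
  open import Algebra.Properties.Ring ring using (x∙y⁻¹≈ε⇒x≈y)
  open import Relation.Binary.Reasoning.Setoid setoid

  -- monic (a₀ ∷ a₁ ∷ … ∷ a_{d-1}) x = x^d + a_{d-1} x^{d-1} + ⋯ + a₀
  monic : List Carrier → Carrier → Carrier
  monic []       x = 1#
  monic (a ∷ as) x = a + x * monic as x

  quotient : Carrier → List Carrier → Carrier → List Carrier
  quotient a []        r = []
  quotient a (a′ ∷ as) r = monic (a′ ∷ as) r ∷ quotient a′ as r

  length-quotient : ∀ a as r → length (quotient a as r) ≡ length as
  length-quotient a []        r = ≡.refl
  length-quotient a (a′ ∷ as) r = ≡.cong suc (length-quotient a′ as r)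

  monic-division : ∀ a as r x →
    monic (a ∷ as) x ≈ (x - r) * monic (quotient a as r) x + monic (a ∷ as) r
  monic-division a []        r x = linear a x r 1#
    where
    linear : ∀ a x r u → a + x * u ≈ (x - r) * u + (a + r * u)
    linear = solve 4 (λ a x r u → a :+ x :* u := (x :- r) :* u :+ (a :+ r :* u)) refl
  monic-division a (a′ ∷ as) r x = begin
    a + x * monic (a′ ∷ as) x           ≈⟨ +-congˡ (*-congˡ (monic-division a′ as r x)) ⟩
    a + x * ((x - r) * monic q x + m r) ≈⟨ horner a x r (monic q x) (m r) ⟩
    (x - r) * (m r + x * monic q x) + (a + r * m r) ∎
    where
    q = quotient a′ as r
    m = monic (a′ ∷ as)
    horner : ∀ a x r u v → a + x * ((x - r) * u + v) ≈ (x - r) * (v + x * u) + (a + r * v)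
    horner = solve 5 (λ a x r u v →
      a :+ x :* ((x :- r) :* u :+ v) := (x :- r) :* (v :+ x :* u) :+ (a :+ r :* v)) refl

  monic-zeros-++ : ∀ n as x → monic (replicate n 0# ++ as) x ≈ x ^ n * monic as x
  monic-zeros-++ zero    as x = sym (*-identityˡ _)
  monic-zeros-++ (suc n) as x = begin
    0# + x * monic (replicate n 0# ++ as) x ≈⟨ +-identityˡ _ ⟩
    x * monic (replicate n 0# ++ as) x      ≈⟨ *-congˡ (monic-zeros-++ n as x) ⟩
    x * (x ^ n * monic as x)                ≈⟨ *-assoc x (x ^ n) (monic as x) ⟨
    x ^ suc n * monic as x                  ∎

  trinomial : ℕ → ℕ → List Carrier
  trinomial m n = 0# ∷ 1# ∷ replicate m 0# ++ 1# ∷ replicate n 0#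

  length-trinomial : ∀ m n → length (trinomial m n) ≡ 2 ℕ.+ m ℕ.+ suc n
  length-trinomial m n = ≡.cong (2 ℕ.+_) (≡.trans (length-++ (replicate m 0#))
    (≡.cong₂ ℕ._+_ (length-replicate m) (≡.cong suc (length-replicate n))))

  monic-trinomial : ∀ m n x → monic (trinomial m n) x ≈ x + x ^ (2 ℕ.+ m) + x ^ (2 ℕ.+ m ℕ.+ suc n)
  monic-trinomial m n x = begin
    0# + x * (1# + x * monic (replicate m 0# ++ 1# ∷ replicate n 0#) x)
      ≈⟨ +-congˡ (*-congˡ (+-congˡ (*-congˡ (monic-zeros-++ m (1# ∷ replicate n 0#) x)))) ⟩
    0# + x * (1# + x * (x ^ m * (1# + x * monic (replicate n 0#) x)))
      ≈⟨ +-congˡ (*-congˡ (+-congˡ (*-congˡ (*-congˡ (+-congˡ (*-congˡ (x^n≈monic n))))))) ⟨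
    0# + x * (1# + x * (x ^ m * (1# + x * x ^ n)))
      ≈⟨ expand x (x ^ m) (x ^ n) ⟩
    x + x * (x * x ^ m) + x * (x * (x ^ m * x ^ suc n))
      ≈⟨ +-congˡ (*-congˡ (*-congˡ (^-homo-* x m (suc n)))) ⟨
    x + x ^ (2 ℕ.+ m) + x ^ (2 ℕ.+ m ℕ.+ suc n) ∎
    where
    open import Algebra.Properties.Semiring.Exp semiring using (^-homo-*)
    x^n≈monic : ∀ n → x ^ n ≈ monic (replicate n 0#) x
    x^n≈monic zero    = refl
    x^n≈monic (suc n) = trans (*-congˡ (x^n≈monic n)) (sym (+-identityˡ _))
    expand : ∀ x y z → 0# + x * (1# + x * (y * (1# + x * z))) ≈ x + x * (x * y) + x * (x * (y * (x * z)))
    expand x y z = begin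
      0# + x * (1# + x * (y * (1# + x * z)))     ≈⟨ +-identityˡ _ ⟩
      x * (1# + x * (y * (1# + x * z)))          ≈⟨ distribute x y z 1# ⟩
      x * 1# + x * (x * y) * 1# + x * (x * (y * (x * z)))
                                                 ≈⟨ +-congʳ (+-cong (*-identityʳ x) (*-identityʳ _)) ⟩
      x + x * (x * y) + x * (x * (y * (x * z)))  ∎
      where
      distribute : ∀ x y z u →
        x * (u + x * (y * (u + x * z))) ≈ x * u + x * (x * y) * u + x * (x * (y * (x * z)))
      distribute = solve 4 (λ x y z u →
        x :* (u :+ x :* (y :* (u :+ x :* z)))
        := x :* u :+ x :* (x :* y) :* u :+ x :* (x :* (y :* (x :* z)))) refl

  roots≤degree : ∀ {m} as (ρ : Fin m → Carrier) → Injective ≡._≡_ _≈_ ρ →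
                 (∀ i → monic as (ρ i) ≈ 0#) → m ℕ.≤ length as
  roots≤degree {ℕ.zero}  as       ρ ρ-injective roots = ℕ.z≤n
  roots≤degree {suc m}     []       ρ ρ-injective roots = ⊥-elim (1≉0 (roots Fin.zero))
  roots≤degree {suc m}     (a ∷ as) ρ ρ-injective roots = ℕ.s≤s (≡.subst (m ℕ.≤_)
    (length-quotient a as r)
    (roots≤degree (quotient a as r) (ρ ∘ Fin.suc) (Fin.suc-injective ∘ ρ-injective) quotient-roots))
    where
    r = ρ Fin.zero
    quotient-roots : ∀ i → monic (quotient a as r) (ρ (Fin.suc i)) ≈ 0#
    quotient-roots i = x≉0∧xy≈0⇒y≈0 ρi-r≉0 (begin
      (ρi - r) * monic (quotient a as r) ρi                     ≈⟨ +-identityʳ _ ⟨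
      (ρi - r) * monic (quotient a as r) ρi + 0#                ≈⟨ +-congˡ (roots Fin.zero) ⟨
      (ρi - r) * monic (quotient a as r) ρi + monic (a ∷ as) r  ≈⟨ monic-division a as r ρi ⟨
      monic (a ∷ as) ρi                                         ≈⟨ roots (Fin.suc i) ⟩
      0#                                                        ∎)
      where
      ρi = ρ (Fin.suc i)
      ρi-r≉0 : ρi - r ≉ 0#
      ρi-r≉0 ρi-r≈0 with () ← ρ-injective (x∙y⁻¹≈ε⇒x≈y _ _ ρi-r≈0)

module FiniteField {c ℓ} (K : Field c ℓ) {N : ℕ}
                   (enumeration : Bijection (≡-setoid (Fin N)) (Field.setoid K)) where
  open Field K
  open FieldProperties K
  open MonicPolynomials K using (monic; roots≤degree)
  open Bijection enumeration using (to⁻; strictlySurjective)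
    renaming (to to element; cong to element-cong; injective to element-injective)
  open import Relation.Binary.Reasoning.Setoid setoid

  index : Carrier → Fin N
  index = to⁻

  element-index : ∀ x → element (index x) ≈ x
  element-index x = proj₂ (strictlySurjective x)

  _≟_ : Decidable _≈_
  x ≟ y with index x Fin.≟ index y
  ... | yes eq = yes (begin
          x                  ≈⟨ element-index x ⟨
          element (index x)  ≈⟨ element-cong eq ⟩
          element (index y)  ≈⟨ element-index y ⟩
          y                  ∎)
  ... | no neq = no λ x≈y → neq (element-injective (begin
          element (index x)  ≈⟨ element-index x ⟩
          x                  ≈⟨ x≈y ⟩
          y                  ≈⟨ element-index y ⟨
          element (index y)  ∎))

  injective⇒surjective : ∀ {h : Carrier → Carrier} → Congruent _≈_ _≈_ h → Injective _≈_ _≈_ h →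
                         Surjective _≈_ _≈_ h
  injective⇒surjective {h} h-cong h-injective y = element i , λ z≈ → begin
      h _                        ≈⟨ h-cong z≈ ⟩
      h (element i)              ≈⟨ element-index _ ⟨
      element (index (h (element i))) ≈⟨ element-cong hi≡ ⟩
      element (index y)          ≈⟨ element-index y ⟩
      y                          ∎
    where
    h′ : Fin N → Fin N
    h′ i = index (h (element i))
    h′-injective : Injective ≡._≡_ ≡._≡_ h′
    h′-injective eq = element-injective (h-injective (begin
      h (element _)              ≈⟨ element-index _ ⟨
      element (h′ _)             ≈⟨ element-cong eq ⟩
      element (h′ _)             ≈⟨ element-index _ ⟩
      h (element _)              ∎))
    i = proj₁ (Fin-injective⇒surjective h′ h′-injective (index y))
    hi≡ = proj₂ (Fin-injective⇒surjective h′ h′-injective (index y))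

  module _ {m ℓm} (M : CommutativeMonoid m ℓm) where
    private module M = CommutativeMonoid M
    open CommutativeMonoidSum M using (sum; ∑-permute; sum-cong-≋)

    ∑-reindex : (f : Carrier → M.Carrier) → (∀ {x y} → x ≈ y → f x M.≈ f y) →
                (τ τ⁻¹ : Carrier → Carrier) → Congruent _≈_ _≈_ τ → Congruent _≈_ _≈_ τ⁻¹ →
                (∀ x → τ (τ⁻¹ x) ≈ x) → (∀ x → τ⁻¹ (τ x) ≈ x) →
                sum (f ∘ element) M.≈ sum (f ∘ τ ∘ element)
    ∑-reindex f f-cong τ τ⁻¹ τ-cong τ⁻¹-cong τ∘τ⁻¹ τ⁻¹∘τ =
      M.trans (∑-permute (f ∘ element) π) (sum-cong-≋ {N} (λ i → f-cong (element-index (τ (element i)))))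
      where
      π = permutation (index ∘ τ ∘ element) (index ∘ τ⁻¹ ∘ element)
        (λ i → element-injective (trans (element-index _) (trans (τ-cong (element-index _)) (τ∘τ⁻¹ _))))
        (λ i → element-injective (trans (element-index _) (trans (τ⁻¹-cong (element-index _)) (τ⁻¹∘τ _))))

  private
    module Σ = CommutativeMonoidSum +-commutativeMonoid
    module Π = CommutativeMonoidSum *-commutativeMonoid

  -- Translation by 1 permutes K, so Σ x = Σ (x + 1) = Σ x + N · 1.
  N×1≈0 : N × 1# ≈ 0#
  N×1≈0 = +-cancelˡ total _ _ (begin
      total + N × 1#                  ≈⟨ +-congˡ (Σ.sum-replicate N) ⟨
      total + Σ.sum {N} (λ _ → 1#)    ≈⟨ Σ.∑-distrib-+ element (λ _ → 1#) ⟨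
      Σ.sum (λ i → element i + 1#)   ≈⟨ ∑-reindex +-commutativeMonoid (λ x → x) (λ x≈y → x≈y)
                                          (_+ 1#) (_- 1#) +-congʳ +-congʳ
                                          (//-rightDividesˡ 1#) (//-rightDividesʳ 1#) ⟨
      total                          ≈⟨ +-identityʳ total ⟨
      total + 0#                     ∎)
    where
    open import Algebra.Properties.Ring ring using (+-cancelˡ; //-rightDividesˡ; //-rightDividesʳ)
    total = Σ.sum element

  -- For x ≉ 0, multiplication by x permutes K. The products below run over all of K with 0
  -- replaced by 1; atZero x y supplies the factor x that this loses at y ≈ 0, so x^N P ≈ P x.
  0↦1 : Carrier → Carrier
  0↦1 y with y ≟ 0#
  ... | yes _ = 1#
  ... | no  _ = y

  0↦1-≉0 : ∀ y → 0↦1 y ≉ 0#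
  0↦1-≉0 y with y ≟ 0#
  ... | yes _   = 1≉0
  ... | no  y≉0 = y≉0

  0↦1-cong : Congruent _≈_ _≈_ 0↦1
  0↦1-cong {x} {y} x≈y with x ≟ 0# | y ≟ 0#
  ... | yes _   | yes _   = refl
  ... | yes x≈0 | no  y≉0 = ⊥-elim (y≉0 (trans (sym x≈y) x≈0))
  ... | no  x≉0 | yes y≈0 = ⊥-elim (x≉0 (trans x≈y y≈0))
  ... | no  _   | no  _   = x≈y

  atZero : Carrier → Carrier → Carrier
  atZero x y with y ≟ 0#
  ... | yes _ = x
  ... | no  _ = 1#

  *-0↦1 : ∀ {x} y → x ≉ 0# → x * 0↦1 y ≈ 0↦1 (x * y) * atZero x y
  *-0↦1 {x} y x≉0 with y ≟ 0# | (x * y) ≟ 0#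
  ... | yes _   | yes _    = trans (*-identityʳ x) (sym (*-identityˡ x))
  ... | yes y≈0 | no  xy≉0 = ⊥-elim (xy≉0 (trans (*-congˡ y≈0) (zeroʳ x)))
  ... | no  y≉0 | yes xy≈0 = ⊥-elim (x≉0∧y≉0⇒xy≉0 x≉0 y≉0 xy≈0)
  ... | no  _   | no  _    = sym (*-identityʳ _)

  ∏-atZero : ∀ x → Π.sum (atZero x ∘ element) ≈ x
  ∏-atZero x = trans (sum-single *-commutativeMonoid (atZero x ∘ element) (index 0#) elsewhere) at-0
    where
    at-0 : atZero x (element (index 0#)) ≈ x
    at-0 with element (index 0#) ≟ 0#
    ... | yes _ = refl
    ... | no  ≉0 = ⊥-elim (≉0 (element-index 0#))
    elsewhere : ∀ i → i ≢ index 0# → atZero x (element i) ≈ 1#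
    elsewhere i i≢0 with element i ≟ 0#
    ... | yes ≈0 = ⊥-elim (i≢0 (element-injective (trans ≈0 (sym (element-index 0#)))))
    ... | no  _  = refl

  ∏-≉0 : ∀ {n} (f : Fin n → Carrier) → (∀ i → f i ≉ 0#) → Π.sum f ≉ 0#
  ∏-≉0 {ℕ.zero}  f f≉0 = 1≉0
  ∏-≉0 {suc n} f f≉0 = x≉0∧y≉0⇒xy≉0 (f≉0 Fin.zero) (∏-≉0 (f ∘ Fin.suc) (f≉0 ∘ Fin.suc))

  x^N≈x : ∀ x → x ^ N ≈ x
  x^N≈x x with x ≟ 0#
  ... | yes x≈0 = begin
    x ^ N  ≈⟨ ^-congˡ N x≈0 ⟩
    0# ^ N ≈⟨ 0^n≈0 (index 0#) ⟩
    0#     ≈⟨ x≈0 ⟨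
    x      ∎
    where
    open import Algebra.Properties.Semiring.Exp semiring using (^-congˡ)
    0^n≈0 : ∀ {n} → Fin n → 0# ^ n ≈ 0#
    0^n≈0 {suc n} _ = zeroˡ _
  ... | no  x≉0 = *-cancelʳ-≉0 (∏-≉0 (0↦1 ∘ element) (0↦1-≉0 ∘ element)) (begin
    x ^ N * P                                        ≈⟨ *-congʳ (Π.sum-replicate N) ⟨
    Π.sum {N} (λ _ → x) * P                          ≈⟨ Π.∑-distrib-+ (λ _ → x) (0↦1 ∘ element) ⟨
    Π.sum (λ i → x * 0↦1 (element i))                ≈⟨ Π.sum-cong-≋ {N} (λ i → *-0↦1 (element i) x≉0) ⟩
    Π.sum (λ i → 0↦1 (x * element i) * atZero x (element i))
                                        ≈⟨ Π.∑-distrib-+ (λ i → 0↦1 (x * element i)) (atZero x ∘ element) ⟩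
    Π.sum (λ i → 0↦1 (x * element i)) * Π.sum (atZero x ∘ element)
                                                     ≈⟨ *-cong scaling-invariance (∏-atZero x) ⟩
    P * x                                            ≈⟨ *-comm P x ⟩
    x * P                                            ∎)
    where
    P = Π.sum (0↦1 ∘ element)
    x⁻¹ = proj₁ (inverse x x≉0)
    xx⁻¹≈1 = proj₂ (inverse x x≉0)
    scaling-invariance : Π.sum (λ i → 0↦1 (x * element i)) ≈ P
    scaling-invariance = sym (∑-reindex *-commutativeMonoid 0↦1 0↦1-cong (x *_) (x⁻¹ *_) *-congˡ *-congˡ
      (λ y → trans (sym (*-assoc x x⁻¹ y)) (trans (*-congʳ xx⁻¹≈1) (*-identityˡ y)))
      (λ y → trans (sym (*-assoc x⁻¹ x y)) (trans (*-congʳ (trans (*-comm x⁻¹ x) xx⁻¹≈1)) (*-identityˡ y))))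

  x^n≈0⇒x≈0 : ∀ {x} n → x ^ n ≈ 0# → x ≈ 0#
  x^n≈0⇒x≈0 {x} n x^n≈0 with x ≟ 0#
  ... | yes x≈0 = x≈0
  ... | no  x≉0 = ⊥-elim (x^n≉0 n x^n≈0)
    where
    x^n≉0 : ∀ n → x ^ n ≉ 0#
    x^n≉0 zero    = 1≉0
    x^n≉0 (suc n) = x≉0∧y≉0⇒xy≉0 x≉0 (x^n≉0 n)

  monic-nonvanishing : ∀ as → length as ℕ.< N → ¬ (∀ x → monic as x ≈ 0#)
  monic-nonvanishing as deg<N vanishing =
    ℕ.<⇒≱ deg<N (roots≤degree as element element-injective (vanishing ∘ element))

prime∤factorial : ∀ {p} → Prime p → ∀ m → m ℕ.< p → p ∤ m !
prime∤factorial p-prime zero    m<p p∣1 with ∣1⇒≡1 p∣1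
... | ≡.refl = ¬prime[1] p-prime
prime∤factorial p-prime (suc m) m<p p∣m! with euclidsLemma (suc m) (m !) p-prime p∣m!
... | inj₁ p∣m = ℕ.<⇒≱ m<p (∣⇒≤ p∣m)
... | inj₂ p∣m! = prime∤factorial p-prime m (ℕ.<-trans (ℕ.n<1+n m) m<p) p∣m!

prime∣binomial : ∀ {p} → Prime p → ∀ k → 0 ℕ.< k → k ℕ.< p → p ∣ p choose k
prime∣binomial {zero} p-prime k 0<k k<p = ⊥-elim (¬prime[0] p-prime)
prime∣binomial {p@(suc p′)} p-prime k 0<k k<p
  with euclidsLemma (p choose k) (k ! ℕ.* (p ℕ.∸ k) !) p-prime p∣C*k![p-k]!
  where
  instance _ = k ℕ.!* (p ℕ.∸ k) !≢0
  C*k![p-k]!≡p! : (p choose k) ℕ.* (k ! ℕ.* (p ℕ.∸ k) !) ≡ p !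
  C*k![p-k]!≡p! = ≡.trans (≡.cong (ℕ._* (k ! ℕ.* (p ℕ.∸ k) !)) (nCk≡n!/k![n-k]! (ℕ.<⇒≤ k<p)))
                          (m/n*n≡m (k![n∸k]!∣n! (ℕ.<⇒≤ k<p)))
  p∣C*k![p-k]! : p ∣ (p choose k) ℕ.* (k ! ℕ.* (p ℕ.∸ k) !)
  p∣C*k![p-k]! = ≡.subst (p ∣_) (≡.sym C*k![p-k]!≡p!) (m∣m*n (p′ !))
... | inj₁ p∣C = p∣C
... | inj₂ p∣k!*[p-k]! with euclidsLemma (k !) ((p ℕ.∸ k) !) p-prime p∣k!*[p-k]!
...   | inj₁ p∣k! = ⊥-elim (prime∤factorial p-prime k k<p p∣k!)
...   | inj₂ p∣[p-k]! = ⊥-elim (prime∤factorial p-prime (p ℕ.∸ k) (ℕ.∸-monoʳ-< 0<k (ℕ.<⇒≤ k<p)) p∣[p-k]!)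

module _ {c ℓ} (S : CommutativeSemiring c ℓ) where
  open CommutativeSemiring S
  open import Algebra.Properties.Semiring.Mult semiring using (_×_; ×-assoc-*; ×-congʳ)
  open import Algebra.Properties.Semiring.Exp semiring using (_^_)
  import Algebra.Properties.CommutativeSemiring.Binomial S as Binomial
  open import Relation.Binary.Reasoning.Setoid setoid

  freshmansDream : ∀ n .{{_ : ℕ.NonZero n}} → (∀ k → 0 ℕ.< k → k ℕ.< n → (n choose k) × 1# ≈ 0#) →
                   ∀ x y → (x + y) ^ n ≈ x ^ n + y ^ n
  freshmansDream n@(suc m) binomial≈0 x y = begin
    (x + y) ^ n                                ≈⟨ Binomial.theorem n x y ⟩
    term Fin.zero + sum (term ∘ Fin.suc)
      ≈⟨ +-congˡ (sum-single +-commutativeMonoid (term ∘ Fin.suc) (Fin.fromℕ m) inner≈0) ⟩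
    term Fin.zero + term (Fin.fromℕ n)         ≈⟨ +-cong first last ⟩
    y ^ n + x ^ n                              ≈⟨ +-comm _ _ ⟩
    x ^ n + y ^ n                              ∎
    where
    open import Algebra.Properties.Semiring.Sum semiring using (sum)
    term = Binomial.binomialTerm x y n
    first : term Fin.zero ≈ y ^ n
    first = trans (+-identityʳ _) (*-identityˡ _)
    last : term (Fin.fromℕ n) ≈ x ^ n
    last rewrite Fin.toℕ-fromℕ m | nCn≡1 n | ℕ.n∸n≡0 m = trans (+-identityʳ _) (*-identityʳ _)
    inner≈0 : ∀ j → j ≢ Fin.fromℕ m → term (Fin.suc j) ≈ 0#
    inner≈0 j j≢m = begin
      (n choose k) × b           ≈⟨ ×-congʳ (n choose k) (*-identityˡ b) ⟨
      (n choose k) × (1# * b)    ≈⟨ ×-assoc-* (n choose k) 1# b ⟨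
      ((n choose k) × 1#) * b    ≈⟨ *-congʳ (binomial≈0 k (ℕ.s≤s ℕ.z≤n) (ℕ.s≤s j<m)) ⟩
      0# * b                     ≈⟨ zeroˡ b ⟩
      0#                         ∎
      where
      k = suc (Fin.toℕ j)
      b = Binomial.binomial x y n (Fin.suc j)
      j<m : Fin.toℕ j ℕ.< m
      j<m = ℕ.≤∧≢⇒< (≡.subst (Fin.toℕ j ℕ.≤_) (Fin.toℕ-fromℕ m) (Fin.≤fromℕ j))
                     (λ j≡m → j≢m (Fin.toℕ-injective (≡.trans j≡m (≡.sym (Fin.toℕ-fromℕ m)))))

module _ {c ℓ} (R : Ring c ℓ) where
  open Ring R
  open RingMorphisms rawRing rawRing using (IsRingHomomorphism)
  open import Algebra.Properties.Ring R using (x+x≈x⇒x≈0; +-inverseˡ-unique)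

  additive∧multiplicative⇒isRingHomomorphism : ∀ {σ} → Congruent _≈_ _≈_ σ →
    (∀ x y → σ (x + y) ≈ σ x + σ y) → (∀ x y → σ (x * y) ≈ σ x * σ y) → σ 1# ≈ 1# →
    IsRingHomomorphism σ
  additive∧multiplicative⇒isRingHomomorphism {σ} σ-cong σ-+ σ-* σ-1 = record
    { isSemiringHomomorphism = record
      { isNearSemiringHomomorphism = record
        { +-isMonoidHomomorphism = record
          { isMagmaHomomorphism = record
            { isRelHomomorphism = record { cong = σ-cong }
            ; homo = σ-+
            }
          ; ε-homo = σ-0
          }
        ; *-homo = σ-*
        }
      ; 1#-homo = σ-1
      }
    ; -‿homo = σ-neg
    }
    where
    σ-0 : σ 0# ≈ 0#
    σ-0 = x+x≈x⇒x≈0 (σ 0#) (trans (sym (σ-+ 0# 0#)) (σ-cong (+-identityʳ 0#)))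
    σ-neg : ∀ x → σ (- x) ≈ - σ x
    σ-neg x = +-inverseˡ-unique (σ (- x)) (σ x)
                (trans (sym (σ-+ (- x) x)) (trans (σ-cong (-‿inverseˡ x)) σ-0))

module _ {c ℓ} (R : CommutativeRing c ℓ) where
  open CommutativeRing R
  open Algebra.Properties.Semiring.Mult semiring using (_×_)

  module Characteristic {p} (p-prime : Prime p) (p×1≈0 : p × 1# ≈ 0#) where
    open import Algebra.Properties.Semiring.Mult semiring using (×-homo-+; ×1-homo-*)
    open import Algebra.Properties.Semiring.Exp semiring using (_^_; ^-congˡ; ^-assocʳ)
    open import Algebra.Properties.CommutativeSemiring.Exp commutativeSemiring using (^-distrib-*)
    open RingMorphisms rawRing rawRing using (IsRingHomomorphism)
    open import Relation.Binary.Reasoning.Setoid setoid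

    p∣n⇒n×1≈0 : ∀ {n} → p ∣ n → n × 1# ≈ 0#
    p∣n⇒n×1≈0 (divides d ≡.refl) = trans (×1-homo-* d p) (trans (*-congˡ p×1≈0) (zeroʳ _))

    ^p-+ : ∀ x y → (x + y) ^ p ≈ x ^ p + y ^ p
    ^p-+ = freshmansDream commutativeSemiring p {{prime⇒nonZero p-prime}}
      (λ k 0<k k<p → p∣n⇒n×1≈0 (prime∣binomial p-prime k 0<k k<p))

    ^p^n-+ : ∀ n x y → (x + y) ^ (p ^ℕ n) ≈ x ^ (p ^ℕ n) + y ^ (p ^ℕ n)
    ^p^n-+ zero    x y = trans (*-identityʳ _) (+-cong (sym (*-identityʳ x)) (sym (*-identityʳ y)))
    ^p^n-+ (suc n) x y = begin
      (x + y) ^ (p ℕ.* p ^ℕ n)                ≈⟨ ^-assocʳ (x + y) p (p ^ℕ n) ⟨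
      ((x + y) ^ p) ^ (p ^ℕ n)                ≈⟨ ^-congˡ (p ^ℕ n) (^p-+ x y) ⟩
      (x ^ p + y ^ p) ^ (p ^ℕ n)              ≈⟨ ^p^n-+ n (x ^ p) (y ^ p) ⟩
      (x ^ p) ^ (p ^ℕ n) + (y ^ p) ^ (p ^ℕ n) ≈⟨ +-cong (^-assocʳ x p (p ^ℕ n)) (^-assocʳ y p (p ^ℕ n)) ⟩
      x ^ (p ℕ.* p ^ℕ n) + y ^ (p ℕ.* p ^ℕ n) ∎

    ^p^n-isRingHomomorphism : ∀ n → IsRingHomomorphism (_^ (p ^ℕ n))
    ^p^n-isRingHomomorphism n = additive∧multiplicative⇒isRingHomomorphism ring
      (^-congˡ (p ^ℕ n)) (^p^n-+ n) (λ x y → ^-distrib-* x y (p ^ℕ n)) (1^m≈1 (p ^ℕ n))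
      where
      1^m≈1 : ∀ m → 1# ^ m ≈ 1#
      1^m≈1 zero    = refl
      1^m≈1 (suc m) = trans (*-identityˡ _) (1^m≈1 m)

    odd⇒2×1≈0⇒1≈0 : p ≢ 2 → 2 × 1# ≈ 0# → 1# ≈ 0#
    odd⇒2×1≈0⇒1≈0 p≢2 2×1≈0 with p % 2 | m%n<n p 2 | m≡m%n+[m/n]*n p 2
    ... | 0 | _ | p≡[p/2]*2 = ⊥-elim (p≢2 (≡.sym 2≡p))
      where
      2≡p : 2 ≡ p
      2≡p with prime⇒irreducible p-prime (divides (p / 2) p≡[p/2]*2)
      ... | inj₁ ()
      ... | inj₂ 2≡p = 2≡p
    ... | 1 | _ | p≡1+[p/2]*2 = begin
      1#                              ≈⟨ +-identityʳ 1# ⟨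
      1 × 1#                          ≈⟨ +-identityʳ _ ⟨
      1 × 1# + 0#                     ≈⟨ +-congˡ (zeroʳ _) ⟨
      1 × 1# + ((p / 2) × 1#) * 0#    ≈⟨ +-congˡ (*-congˡ 2×1≈0) ⟨
      1 × 1# + ((p / 2) × 1#) * (2 × 1#) ≈⟨ +-congˡ (×1-homo-* (p / 2) 2) ⟨
      1 × 1# + ((p / 2) ℕ.* 2) × 1#   ≈⟨ ×-homo-+ 1# 1 ((p / 2) ℕ.* 2) ⟨
      (1 ℕ.+ (p / 2) ℕ.* 2) × 1#      ≡⟨ ≡.cong (_× 1#) p≡1+[p/2]*2 ⟨
      p × 1#                          ≈⟨ p×1≈0 ⟩
      0#                              ∎
    ... | suc (suc _) | ℕ.s≤s (ℕ.s≤s ()) | _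

-- Stated over a raw ring so that the same definitions serve as solver syntax and, definitionally, as their evaluation.
-- Triples x₀ x₁ x₂ stand for x, σ x, σ² x; cyclicᵢⱼₖ sums the cyclic shifts of x₀ⁱ x₁ʲ x₂ᵏ.
-- polar is the bilinear part of quadratic, written as the first row of its Dickson matrix,
-- whose other rows are the conjugates of the first.
module DicksonForms {a ℓ} (R : RawRing a ℓ) where
  open RawRing R
  open import Algebra.Definitions.RawSemiring rawSemiring using (_×_)

  private
    infixl 6 _-_
    _-_ : Carrier → Carrier → Carrier
    x - y = x + - y

  linearized : (a b c x₀ x₁ x₂ : Carrier) → Carrier
  linearized a b c x₀ x₁ x₂ = a * x₂ + b * x₁ + c * x₀

  adjoint : (a b c x₀ x₁ x₂ : Carrier) → Carrier
  adjoint a b c x₀ x₁ x₂ = a * x₁ + b * x₂ + c * x₀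

  α β γ δ : (a b c : Carrier) → Carrier
  α a b c = a * b * c
  β a b c = a * a * b + a * c * c + b * b * c
  γ a b c = a * a * c + a * b * b + b * c * c
  δ a b c = a * a * a + b * b * b + c * c * c + 3 × (a * b * c)

  cyclic₃₀₀ cyclic₂₁₀ cyclic₂₀₁ cyclic₁₁₁ : (x₀ x₁ x₂ : Carrier) → Carrier
  cyclic₃₀₀ x₀ x₁ x₂ = x₀ * x₀ * x₀ + x₁ * x₁ * x₁ + x₂ * x₂ * x₂
  cyclic₂₁₀ x₀ x₁ x₂ = x₀ * x₀ * x₁ + x₁ * x₁ * x₂ + x₂ * x₂ * x₀
  cyclic₂₀₁ x₀ x₁ x₂ = x₀ * x₀ * x₂ + x₁ * x₁ * x₀ + x₂ * x₂ * x₁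
  cyclic₁₁₁ x₀ x₁ x₂ = x₀ * x₁ * x₂

  quadratic : (A B C D E x₀ x₁ x₂ : Carrier) → Carrier
  quadratic A B C D E x₀ x₁ x₂ =
    E * (x₀ * x₀) + A * (x₁ * x₀) + B * (x₂ * x₀) + C * (x₁ * x₁) + D * (x₂ * x₂)

  dickson₀ dickson₁ dickson₂ : (A B C D E ε₀ ε₁ ε₂ : Carrier) → Carrier
  dickson₀ A B C D E ε₀ ε₁ ε₂ = 2 × (E * ε₀) + A * ε₁ + B * ε₂
  dickson₁ A B C D E ε₀ ε₁ ε₂ = A * ε₀ + 2 × (C * ε₁)
  dickson₂ A B C D E ε₀ ε₁ ε₂ = B * ε₀ + 2 × (D * ε₂)

  polar : (A B C D E z₀ z₁ z₂ ε₀ ε₁ ε₂ : Carrier) → Carrier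
  polar A B C D E z₀ z₁ z₂ ε₀ ε₁ ε₂ =
    dickson₀ A B C D E ε₀ ε₁ ε₂ * z₀ + dickson₁ A B C D E ε₀ ε₁ ε₂ * z₁ + dickson₂ A B C D E ε₀ ε₁ ε₂ * z₂

  det₃ : (m₀₀ m₀₁ m₀₂ m₁₀ m₁₁ m₁₂ m₂₀ m₂₁ m₂₂ : Carrier) → Carrier
  det₃ m₀₀ m₀₁ m₀₂ m₁₀ m₁₁ m₁₂ m₂₀ m₂₁ m₂₂ =
    m₀₀ * (m₁₁ * m₂₂ - m₁₂ * m₂₁) - m₀₁ * (m₁₀ * m₂₂ - m₁₂ * m₂₀) + m₀₂ * (m₁₀ * m₂₁ - m₁₁ * m₂₀)

  dicksonDet : (A B C D E ε₀ ε₁ ε₂ : Carrier) → Carrier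
  dicksonDet A B C D E ε₀ ε₁ ε₂ =
    det₃ (d₀ ε₀ ε₁ ε₂) (d₁ ε₀ ε₁ ε₂) (d₂ ε₀ ε₁ ε₂)
         (d₂ ε₁ ε₂ ε₀) (d₀ ε₁ ε₂ ε₀) (d₁ ε₁ ε₂ ε₀)
         (d₁ ε₂ ε₀ ε₁) (d₂ ε₂ ε₀ ε₁) (d₀ ε₂ ε₀ ε₁)
    where
    d₀ d₁ d₂ : (ε₀ ε₁ ε₂ : Carrier) → Carrier
    d₀ = dickson₀ A B C D E
    d₁ = dickson₁ A B C D E
    d₂ = dickson₂ A B C D E

  detα detβ detγ detδ : (A B C D E : Carrier) → Carrier
  detα A B C D E = - (A * A * D) + A * B * E - B * B * C
  detβ A B C D E = A * A * C - A * B * D - 2 × (A * C * D) + 2 × (A * E * E) + B * B * E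
                   - 2 × (B * C * E) + 2 × (B * D * D)
  detγ A B C D E = A * A * E - A * B * C + 2 × (A * C * C) - 2 × (A * D * E) + B * B * D
                   - 2 × (B * C * D) + 2 × (B * E * E)
  detδ A B C D E = A * A * A + B * B * B + 4 × (C * C * C) - 12 × (C * D * E)
                   + 4 × (D * D * D) + 4 × (E * E * E)

module DicksonIdentities {c ℓ} (R : CommutativeRing c ℓ) where
  open CommutativeRing R
  open import Algebra.Properties.Semiring.Mult semiring using (_×_; ×-congʳ)
  open import Relation.Binary.Reasoning.Setoid setoid
  open IntegerCoefficients R
  open DicksonForms rawRing
  private module Poly {n : ℕ} = DicksonForms (polynomialRawRing n)

  dicksonDet-expansion : ∀ A B C D E ε₀ ε₁ ε₂ →
    dicksonDet A B C D E ε₀ ε₁ ε₂ ≈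
    2 × (detα A B C D E * cyclic₃₀₀ ε₀ ε₁ ε₂ + detβ A B C D E * cyclic₂₁₀ ε₀ ε₁ ε₂
       + detγ A B C D E * cyclic₂₀₁ ε₀ ε₁ ε₂ + detδ A B C D E * cyclic₁₁₁ ε₀ ε₁ ε₂)
  dicksonDet-expansion = solve 8 (λ A B C D E ε₀ ε₁ ε₂ →
    Poly.dicksonDet A B C D E ε₀ ε₁ ε₂ :=
    2 :× (Poly.detα A B C D E :* Poly.cyclic₃₀₀ ε₀ ε₁ ε₂
       :+ Poly.detβ A B C D E :* Poly.cyclic₂₁₀ ε₀ ε₁ ε₂
       :+ Poly.detγ A B C D E :* Poly.cyclic₂₀₁ ε₀ ε₁ ε₂
       :+ Poly.detδ A B C D E :* Poly.cyclic₁₁₁ ε₀ ε₁ ε₂)) refl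

  norm-expansion : ∀ a b c ε₀ ε₁ ε₂ →
    adjoint a b c ε₀ ε₁ ε₂ * adjoint a b c ε₁ ε₂ ε₀ * adjoint a b c ε₂ ε₀ ε₁ ≈
    α a b c * cyclic₃₀₀ ε₀ ε₁ ε₂ + β a b c * cyclic₂₁₀ ε₀ ε₁ ε₂
    + γ a b c * cyclic₂₀₁ ε₀ ε₁ ε₂ + δ a b c * cyclic₁₁₁ ε₀ ε₁ ε₂
  norm-expansion = solve 6 (λ a b c ε₀ ε₁ ε₂ →
    Poly.adjoint a b c ε₀ ε₁ ε₂ :* Poly.adjoint a b c ε₁ ε₂ ε₀ :* Poly.adjoint a b c ε₂ ε₀ ε₁ :=
    Poly.α a b c :* Poly.cyclic₃₀₀ ε₀ ε₁ ε₂ :+ Poly.β a b c :* Poly.cyclic₂₁₀ ε₀ ε₁ ε₂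
    :+ Poly.γ a b c :* Poly.cyclic₂₀₁ ε₀ ε₁ ε₂ :+ Poly.δ a b c :* Poly.cyclic₁₁₁ ε₀ ε₁ ε₂) refl

  cramer₃-kernel : ∀ m₀₀ m₀₁ m₀₂ m₁₀ m₁₁ m₁₂ m₂₀ m₂₁ m₂₂ z₀ z₁ z₂ →
    m₀₀ * z₀ + m₀₁ * z₁ + m₀₂ * z₂ ≈ 0# →
    m₁₀ * z₀ + m₁₁ * z₁ + m₁₂ * z₂ ≈ 0# →
    m₂₀ * z₀ + m₂₁ * z₁ + m₂₂ * z₂ ≈ 0# →
    det₃ m₀₀ m₀₁ m₀₂ m₁₀ m₁₁ m₁₂ m₂₀ m₂₁ m₂₂ * z₀ ≈ 0#
  cramer₃-kernel m₀₀ m₀₁ m₀₂ m₁₀ m₁₁ m₁₂ m₂₀ m₂₁ m₂₂ z₀ z₁ z₂ row₀ row₁ row₂ = begin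
    det₃ m₀₀ m₀₁ m₀₂ m₁₀ m₁₁ m₁₂ m₂₀ m₂₁ m₂₂ * z₀
      ≈⟨ cramer₃ m₀₀ m₀₁ m₀₂ m₁₀ m₁₁ m₁₂ m₂₀ m₂₁ m₂₂ z₀ z₁ z₂ ⟨
    (m₁₁ * m₂₂ - m₁₂ * m₂₁) * (m₀₀ * z₀ + m₀₁ * z₁ + m₀₂ * z₂)
    - (m₀₁ * m₂₂ - m₀₂ * m₂₁) * (m₁₀ * z₀ + m₁₁ * z₁ + m₁₂ * z₂)
    + (m₀₁ * m₁₂ - m₀₂ * m₁₁) * (m₂₀ * z₀ + m₂₁ * z₁ + m₂₂ * z₂)
      ≈⟨ +-cong (+-cong (*-congˡ row₀) (-‿cong (*-congˡ row₁))) (*-congˡ row₂) ⟩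
    (m₁₁ * m₂₂ - m₁₂ * m₂₁) * 0# - (m₀₁ * m₂₂ - m₀₂ * m₂₁) * 0# + (m₀₁ * m₁₂ - m₀₂ * m₁₁) * 0#
      ≈⟨ annihilate _ _ _ ⟩
    0# ∎
    where
    cramer₃ : ∀ m₀₀ m₀₁ m₀₂ m₁₀ m₁₁ m₁₂ m₂₀ m₂₁ m₂₂ z₀ z₁ z₂ →
      (m₁₁ * m₂₂ - m₁₂ * m₂₁) * (m₀₀ * z₀ + m₀₁ * z₁ + m₀₂ * z₂)
      - (m₀₁ * m₂₂ - m₀₂ * m₂₁) * (m₁₀ * z₀ + m₁₁ * z₁ + m₁₂ * z₂)
      + (m₀₁ * m₁₂ - m₀₂ * m₁₁) * (m₂₀ * z₀ + m₂₁ * z₁ + m₂₂ * z₂)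
      ≈ det₃ m₀₀ m₀₁ m₀₂ m₁₀ m₁₁ m₁₂ m₂₀ m₂₁ m₂₂ * z₀
    cramer₃ = solve 12 (λ m₀₀ m₀₁ m₀₂ m₁₀ m₁₁ m₁₂ m₂₀ m₂₁ m₂₂ z₀ z₁ z₂ →
      (m₁₁ :* m₂₂ :- m₁₂ :* m₂₁) :* (m₀₀ :* z₀ :+ m₀₁ :* z₁ :+ m₀₂ :* z₂)
      :- (m₀₁ :* m₂₂ :- m₀₂ :* m₂₁) :* (m₁₀ :* z₀ :+ m₁₁ :* z₁ :+ m₁₂ :* z₂)
      :+ (m₀₁ :* m₁₂ :- m₀₂ :* m₁₁) :* (m₂₀ :* z₀ :+ m₂₁ :* z₁ :+ m₂₂ :* z₂)
      := Poly.det₃ m₀₀ m₀₁ m₀₂ m₁₀ m₁₁ m₁₂ m₂₀ m₂₁ m₂₂ :* z₀) refl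
    annihilate : ∀ x y z → x * 0# - y * 0# + z * 0# ≈ 0#
    annihilate = solve 3 (λ x y z → x :* con (+ 0) :- y :* con (+ 0) :+ z :* con (+ 0) := con (+ 0)) refl

  dicksonDet≈2×2×norm : ∀ {a b c A B C D E} ε₀ ε₁ ε₂ →
    detα A B C D E ≈ 2 × α a b c → detβ A B C D E ≈ 2 × β a b c →
    detγ A B C D E ≈ 2 × γ a b c → detδ A B C D E ≈ 2 × δ a b c →
    dicksonDet A B C D E ε₀ ε₁ ε₂ ≈
    2 × (2 × (adjoint a b c ε₀ ε₁ ε₂ * adjoint a b c ε₁ ε₂ ε₀ * adjoint a b c ε₂ ε₀ ε₁))
  dicksonDet≈2×2×norm {a} {b} {c} {A} {B} {C} {D} {E} ε₀ ε₁ ε₂ eqα eqβ eqγ eqδ = begin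
    dicksonDet A B C D E ε₀ ε₁ ε₂
      ≈⟨ dicksonDet-expansion A B C D E ε₀ ε₁ ε₂ ⟩
    2 × (detα A B C D E * s₃₀₀ + detβ A B C D E * s₂₁₀ + detγ A B C D E * s₂₀₁ + detδ A B C D E * s₁₁₁)
      ≈⟨ ×-congʳ 2 (+-cong (+-cong (+-cong (*-congʳ eqα) (*-congʳ eqβ)) (*-congʳ eqγ)) (*-congʳ eqδ)) ⟩
    2 × (2 × α a b c * s₃₀₀ + 2 × β a b c * s₂₁₀ + 2 × γ a b c * s₂₀₁ + 2 × δ a b c * s₁₁₁)
      ≈⟨ ×-congʳ 2 (factor-2 (α a b c) (β a b c) (γ a b c) (δ a b c) s₃₀₀ s₂₁₀ s₂₀₁ s₁₁₁) ⟩
    2 × (2 × (α a b c * s₃₀₀ + β a b c * s₂₁₀ + γ a b c * s₂₀₁ + δ a b c * s₁₁₁))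
      ≈⟨ ×-congʳ 2 (×-congʳ 2 (norm-expansion a b c ε₀ ε₁ ε₂)) ⟨
    2 × (2 × (adjoint a b c ε₀ ε₁ ε₂ * adjoint a b c ε₁ ε₂ ε₀ * adjoint a b c ε₂ ε₀ ε₁)) ∎
    where
    s₃₀₀ = cyclic₃₀₀ ε₀ ε₁ ε₂
    s₂₁₀ = cyclic₂₁₀ ε₀ ε₁ ε₂
    s₂₀₁ = cyclic₂₀₁ ε₀ ε₁ ε₂
    s₁₁₁ = cyclic₁₁₁ ε₀ ε₁ ε₂
    factor-2 : ∀ w x y z s t u v →
      2 × w * s + 2 × x * t + 2 × y * u + 2 × z * v ≈ 2 × (w * s + x * t + y * u + z * v)
    factor-2 = solve 8 (λ w x y z s t u v →
      2 :× w :* s :+ 2 :× x :* t :+ 2 :× y :* u :+ 2 :× z :* v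
      := 2 :× (w :* s :+ x :* t :+ y :* u :+ z :* v)) refl

  linearized-difference : ∀ a b c x₀ x₁ x₂ y₀ y₁ y₂ →
    linearized a b c (x₀ - y₀) (x₁ - y₁) (x₂ - y₂) ≈ linearized a b c x₀ x₁ x₂ - linearized a b c y₀ y₁ y₂
  linearized-difference = solve 9 (λ a b c x₀ x₁ x₂ y₀ y₁ y₂ →
    Poly.linearized a b c (x₀ :- y₀) (x₁ :- y₁) (x₂ :- y₂)
    := Poly.linearized a b c x₀ x₁ x₂ :- Poly.linearized a b c y₀ y₁ y₂) refl

  quadratic-difference : ∀ A B C D E x₀ x₁ x₂ y₀ y₁ y₂ ε₀ ε₁ ε₂ →
    (quadratic A B C D E (x₀ + ε₀) (x₁ + ε₁) (x₂ + ε₂) - quadratic A B C D E x₀ x₁ x₂)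
    - (quadratic A B C D E (y₀ + ε₀) (y₁ + ε₁) (y₂ + ε₂) - quadratic A B C D E y₀ y₁ y₂)
    ≈ polar A B C D E (x₀ - y₀) (x₁ - y₁) (x₂ - y₂) ε₀ ε₁ ε₂
  quadratic-difference = solve 14 (λ A B C D E x₀ x₁ x₂ y₀ y₁ y₂ ε₀ ε₁ ε₂ →
    (Poly.quadratic A B C D E (x₀ :+ ε₀) (x₁ :+ ε₁) (x₂ :+ ε₂) :- Poly.quadratic A B C D E x₀ x₁ x₂)
    :- (Poly.quadratic A B C D E (y₀ :+ ε₀) (y₁ :+ ε₁) (y₂ :+ ε₂) :- Poly.quadratic A B C D E y₀ y₁ y₂)
    := Poly.polar A B C D E (x₀ :- y₀) (x₁ :- y₁) (x₂ :- y₂) ε₀ ε₁ ε₂) refl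

module _ {c ℓ} (K : Field c ℓ) where
  open Field K

  module CyclicCubicExtension {N : ℕ} (enumeration : Bijection (≡-setoid (Fin N)) setoid)
    (σ : Carrier → Carrier)
    (σ-isRingHomomorphism : RingMorphisms.IsRingHomomorphism rawRing rawRing σ)
    (σ³≈id : ∀ x → σ (σ (σ x)) ≈ x)
    (2×1≉0 : 2 × 1# ≉ 0#)
    (trace-nonvanishing : ¬ (∀ t → t + σ t + σ (σ t) ≈ 0#))
    where

    open RingMorphisms.IsRingHomomorphism σ-isRingHomomorphism
      renaming (⟦⟧-cong to σ-cong; +-homo to σ-+; *-homo to σ-*;
                0#-homo to σ-0; 1#-homo to σ-1; -‿homo to σ-neg)
    open FieldProperties K
    open FiniteField K enumeration using (_≟_; injective⇒surjective)
    open IntegerCoefficients commutativeRing using (⟦⟧-homo; ⟦⟧-cong; close; solve; _:=_; _:+_; _:*_)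
    open DicksonForms rawRing
    open DicksonIdentities commutativeRing
    open CommutativeSemigroupProperties +-commutativeSemigroup using (interchange; xy∙z≈zx∙y; xy∙z≈yz∙x)
    open import Algebra.Properties.Ring ring using (x∙y⁻¹≈ε⇒x≈y; x≈y⇒x∙y⁻¹≈ε)
    open import Relation.Binary.Reasoning.Setoid setoid
    private module Poly {n : ℕ} = DicksonForms (IntegerCoefficients.polynomialRawRing commutativeRing n)

    Fixed : Carrier → Set ℓ
    Fixed x = σ x ≈ x

    record Orbit (x₀ x₁ x₂ : Carrier) : Set ℓ where
      field
        σx₀≈x₁ : σ x₀ ≈ x₁
        σx₁≈x₂ : σ x₁ ≈ x₂
        σx₂≈x₀ : σ x₂ ≈ x₀

    orbit : ∀ x → Orbit x (σ x) (σ (σ x))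
    orbit x = record { σx₀≈x₁ = refl ; σx₁≈x₂ = refl ; σx₂≈x₀ = σ³≈id x }

    rotate : ∀ {x₀ x₁ x₂} → Orbit x₀ x₁ x₂ → Orbit x₁ x₂ x₀
    rotate o = record { σx₀≈x₁ = σx₁≈x₂ ; σx₁≈x₂ = σx₂≈x₀ ; σx₂≈x₀ = σx₀≈x₁ }
      where open Orbit o

    σ-difference : ∀ x y → σ (x - y) ≈ σ x - σ y
    σ-difference x y = trans (σ-+ x (- y)) (+-congˡ (σ-neg y))

    orbit-difference : ∀ {x₀ x₁ x₂ y₀ y₁ y₂} → Orbit x₀ x₁ x₂ → Orbit y₀ y₁ y₂ →
              Orbit (x₀ - y₀) (x₁ - y₁) (x₂ - y₂)
    orbit-difference x y = record
      { σx₀≈x₁ = trans (σ-difference _ _) (+-cong X.σx₀≈x₁ (-‿cong Y.σx₀≈x₁))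
      ; σx₁≈x₂ = trans (σ-difference _ _) (+-cong X.σx₁≈x₂ (-‿cong Y.σx₁≈x₂))
      ; σx₂≈x₀ = trans (σ-difference _ _) (+-cong X.σx₂≈x₀ (-‿cong Y.σx₂≈x₀))
      }
      where
      module X = Orbit x
      module Y = Orbit y

    σx≈0⇒x≈0 : ∀ {x} → σ x ≈ 0# → x ≈ 0#
    σx≈0⇒x≈0 {x} σx≈0 with x ≟ 0#
    ... | yes x≈0 = x≈0
    ... | no  x≉0 = ⊥-elim (1≉0 (begin
      1#              ≈⟨ σ-1 ⟨
      σ 1#            ≈⟨ σ-cong (proj₂ (inverse x x≉0)) ⟨
      σ (x * x⁻¹)     ≈⟨ σ-* x x⁻¹ ⟩
      σ x * σ x⁻¹     ≈⟨ *-congʳ σx≈0 ⟩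
      0# * σ x⁻¹      ≈⟨ zeroˡ _ ⟩
      0#              ∎))
      where x⁻¹ = proj₁ (inverse x x≉0)

    Tr : Carrier → Carrier
    Tr t = t + σ t + σ (σ t)

    Tr-cong : ∀ {u v} → u ≈ v → Tr u ≈ Tr v
    Tr-cong u≈v = +-cong (+-cong u≈v (σ-cong u≈v)) (σ-cong (σ-cong u≈v))

    Tr-σ : ∀ u → Tr (σ u) ≈ Tr u
    Tr-σ u = trans (+-congˡ (σ³≈id u)) (xy∙z≈zx∙y (σ u) (σ (σ u)) u)

    Tr-+ : ∀ u v → Tr (u + v) ≈ Tr u + Tr v
    Tr-+ u v = begin
      (u + v) + σ (u + v) + σ (σ (u + v))
        ≈⟨ +-cong (+-congˡ (σ-+ u v)) (trans (σ-cong (σ-+ u v)) (σ-+ (σ u) (σ v))) ⟩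
      (u + v) + (σ u + σ v) + (σ (σ u) + σ (σ v))
        ≈⟨ +-congʳ (interchange u v (σ u) (σ v)) ⟩
      (u + σ u) + (v + σ v) + (σ (σ u) + σ (σ v))
        ≈⟨ interchange (u + σ u) (v + σ v) (σ (σ u)) (σ (σ v)) ⟩
      Tr u + Tr v ∎

    Tr-0 : Tr 0# ≈ 0#
    Tr-0 = trans (+-cong (+-cong refl σ-0) (trans (σ-cong σ-0) σ-0)) (trans (+-identityʳ _) (+-identityʳ _))

    orbit-≉0 : ∀ {x₀ x₁ x₂} → Orbit x₀ x₁ x₂ → x₀ ≉ 0# → x₁ ≉ 0#
    orbit-≉0 o x₀≉0 x₁≈0 = x₀≉0 (σx≈0⇒x≈0 (trans (Orbit.σx₀≈x₁ o) x₁≈0))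

    2×x≉0 : ∀ {x} → x ≉ 0# → 2 × x ≉ 0#
    2×x≉0 {x} x≉0 2x≈0 = x≉0∧y≉0⇒xy≉0 2×1≉0 x≉0 (begin
      (2 × 1#) * x   ≈⟨ ×-assoc-* 2 1# x ⟩
      2 × (1# * x)   ≈⟨ ×-congʳ 2 (*-identityˡ x) ⟩
      2 × x          ≈⟨ 2x≈0 ⟩
      0#             ∎)
      where open import Algebra.Properties.Semiring.Mult semiring using (×-assoc-*; ×-congʳ)

    σ-twist : ∀ {k} → Fixed k → ∀ u v → σ (u * (k * v)) ≈ σ u * (k * σ v)
    σ-twist {k} k-fixed u v = trans (σ-* u (k * v)) (*-congˡ (trans (σ-* k v) (*-congʳ k-fixed)))

    module _ {a b c : Carrier} (a-fixed : Fixed a) (b-fixed : Fixed b) (c-fixed : Fixed c) where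

      g g* : Carrier → Carrier
      g x  = linearized a b c x (σ x) (σ (σ x))
      g* e = adjoint a b c e (σ e) (σ (σ e))

      trace-adjoint : ∀ x e → Tr (e * g x) ≈ Tr (x * g* e)
      trace-adjoint x e = begin
        Tr (e * g x)
          ≈⟨ Tr-cong (trans (distribˡ e _ _) (+-congʳ (distribˡ e _ _))) ⟩
        Tr (e * (a * σ (σ x)) + e * (b * σ x) + e * (c * x))
          ≈⟨ trans (Tr-+ _ _) (+-congʳ (Tr-+ _ _)) ⟩
        Tr (e * (a * σ (σ x))) + Tr (e * (b * σ x)) + Tr (e * (c * x))
          ≈⟨ +-congʳ (+-cong move-a move-b) ⟩
        Tr (σ e * (a * x)) + Tr (σ (σ e) * (b * x)) + Tr (e * (c * x))
          ≈⟨ trans (Tr-+ _ _) (+-congʳ (Tr-+ _ _)) ⟨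
        Tr (σ e * (a * x) + σ (σ e) * (b * x) + e * (c * x))
          ≈⟨ Tr-cong (transpose a b c x (σ e) (σ (σ e)) e) ⟩
        Tr (x * g* e) ∎
        where
        move-a : Tr (e * (a * σ (σ x))) ≈ Tr (σ e * (a * x))
        move-a = begin
          Tr (e * (a * σ (σ x)))       ≈⟨ Tr-σ _ ⟨
          Tr (σ (e * (a * σ (σ x))))   ≈⟨ Tr-cong (σ-twist a-fixed e _) ⟩
          Tr (σ e * (a * σ (σ (σ x)))) ≈⟨ Tr-cong (*-congˡ (*-congˡ (σ³≈id x))) ⟩
          Tr (σ e * (a * x))           ∎
        move-b : Tr (e * (b * σ x)) ≈ Tr (σ (σ e) * (b * x))
        move-b = begin
          Tr (e * (b * σ x))               ≈⟨ trans (Tr-σ _) (Tr-σ _) ⟨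
          Tr (σ (σ (e * (b * σ x))))
            ≈⟨ Tr-cong (trans (σ-cong (σ-twist b-fixed e _)) (σ-twist b-fixed _ _)) ⟩
          Tr (σ (σ e) * (b * σ (σ (σ x)))) ≈⟨ Tr-cong (*-congˡ (*-congˡ (σ³≈id x))) ⟩
          Tr (σ (σ e) * (b * x))           ∎
        transpose : ∀ a b c x u v w → u * (a * x) + v * (b * x) + w * (c * x) ≈ x * adjoint a b c w u v
        transpose = solve 7 (λ a b c x u v w →
          u :* (a :* x) :+ v :* (b :* x) :+ w :* (c :* x) := x :* (a :* u :+ b :* v :+ c :* w)) refl

      g-cong : Congruent _≈_ _≈_ g
      g-cong x≈y = +-cong (+-cong (*-congˡ (σ-cong (σ-cong x≈y))) (*-congˡ (σ-cong x≈y))) (*-congˡ x≈y)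

      g-difference : ∀ x y → g (x - y) ≈ g x - g y
      g-difference x y = begin
        g (x - y)
          ≈⟨ +-congʳ (+-cong (*-congˡ (trans (σ-cong (σ-difference x y)) (σ-difference (σ x) (σ y)))) (*-congˡ (σ-difference x y))) ⟩
        linearized a b c (x - y) (σ x - σ y) (σ (σ x) - σ (σ y))
          ≈⟨ linearized-difference a b c x (σ x) (σ (σ x)) y (σ y) (σ (σ y)) ⟩
        g x - g y ∎

      orbit-adjoint : ∀ {e₀ e₁ e₂} → Orbit e₀ e₁ e₂ →
                      Orbit (adjoint a b c e₀ e₁ e₂) (adjoint a b c e₁ e₂ e₀) (adjoint a b c e₂ e₀ e₁)
      orbit-adjoint e = record
        { σx₀≈x₁ = σ-adjoint e
        ; σx₁≈x₂ = σ-adjoint (rotate e)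
        ; σx₂≈x₀ = σ-adjoint (rotate (rotate e))
        }
        where
        σ-adjoint : ∀ {e₀ e₁ e₂} → Orbit e₀ e₁ e₂ → σ (adjoint a b c e₀ e₁ e₂) ≈ adjoint a b c e₁ e₂ e₀
        σ-adjoint e = ⟦⟧-homo σ-isRingHomomorphism (close 6 Poly.adjoint)
          (a-fixed ∷ b-fixed ∷ c-fixed ∷ σx₀≈x₁ ∷ σx₁≈x₂ ∷ σx₂≈x₀ ∷ [])
          where open Orbit e

      module _ (g-nonvanishing : ∀ x → x ≉ 0# → g x ≉ 0#) where

        g-injective : Injective _≈_ _≈_ g
        g-injective {x} {y} gx≈gy with (x - y) ≟ 0#
        ... | yes x-y≈0 = x∙y⁻¹≈ε⇒x≈y x y x-y≈0
        ... | no  x-y≉0 = ⊥-elim (g-nonvanishing (x - y) x-y≉0 (trans (g-difference x y) (x≈y⇒x∙y⁻¹≈ε gx≈gy)))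

        adjoint-nonvanishing : ∀ e → e ≉ 0# → g* e ≉ 0#
        adjoint-nonvanishing e e≉0 g*e≈0 = trace-nonvanishing λ t →
          let x , gx≈e⁻¹t = injective⇒surjective g-cong g-injective (e⁻¹ * t) in begin
          Tr t               ≈⟨ Tr-cong (e[e⁻¹t]≈t t) ⟨
          Tr (e * (e⁻¹ * t)) ≈⟨ Tr-cong (*-congˡ (gx≈e⁻¹t refl)) ⟨
          Tr (e * g x)       ≈⟨ trace-adjoint x e ⟩
          Tr (x * g* e)      ≈⟨ Tr-cong (trans (*-congˡ g*e≈0) (zeroʳ x)) ⟩
          Tr 0#              ≈⟨ Tr-0 ⟩
          0#                 ∎
          where
          e⁻¹ = proj₁ (inverse e e≉0)
          e[e⁻¹t]≈t : ∀ t → e * (e⁻¹ * t) ≈ t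
          e[e⁻¹t]≈t t =
            trans (sym (*-assoc e e⁻¹ t)) (trans (*-congʳ (proj₂ (inverse e e≉0))) (*-identityˡ t))

        module _ {A B C D E : Carrier}
          (A-fixed : Fixed A) (B-fixed : Fixed B) (C-fixed : Fixed C) (D-fixed : Fixed D) (E-fixed : Fixed E)
          (eqα : detα A B C D E ≈ 2 × α a b c) (eqβ : detβ A B C D E ≈ 2 × β a b c)
          (eqγ : detγ A B C D E ≈ 2 × γ a b c) (eqδ : detδ A B C D E ≈ 2 × δ a b c)
          where

          f : Carrier → Carrier
          f x = quadratic A B C D E x (σ x) (σ (σ x))

          σ-polar : ∀ {z₀ z₁ z₂ ε₀ ε₁ ε₂} → Orbit z₀ z₁ z₂ → Orbit ε₀ ε₁ ε₂ →
                    σ (polar A B C D E z₀ z₁ z₂ ε₀ ε₁ ε₂) ≈ polar A B C D E z₁ z₂ z₀ ε₁ ε₂ ε₀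
          σ-polar z ε = ⟦⟧-homo σ-isRingHomomorphism (close 11 Poly.polar)
            (A-fixed ∷ B-fixed ∷ C-fixed ∷ D-fixed ∷ E-fixed ∷
             Z.σx₀≈x₁ ∷ Z.σx₁≈x₂ ∷ Z.σx₂≈x₀ ∷ Ε.σx₀≈x₁ ∷ Ε.σx₁≈x₂ ∷ Ε.σx₂≈x₀ ∷ [])
            where
            module Z = Orbit z
            module Ε = Orbit ε

          polar-kernel : ∀ {z₀ z₁ z₂ ε} → ε ≉ 0# → Orbit z₀ z₁ z₂ →
                         polar A B C D E z₀ z₁ z₂ ε (σ ε) (σ (σ ε)) ≈ 0# → z₀ ≈ 0#
          polar-kernel {z₀} {z₁} {z₂} {ε} ε≉0 z row₀ = x≉0∧xy≈0⇒y≈0 det≉0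
            -- the conjugate rows, reordered to the column order z₀ z₁ z₂
            (cramer₃-kernel _ _ _ _ _ _ _ _ _ z₀ z₁ z₂ row₀
              (trans (sym (xy∙z≈zx∙y _ _ _)) row₁) (trans (sym (xy∙z≈yz∙x _ _ _)) row₂))
            where
            ε⃗ = orbit ε
            row₁ : polar A B C D E z₁ z₂ z₀ (σ ε) (σ (σ ε)) ε ≈ 0#
            row₁ = trans (sym (σ-polar z ε⃗)) (trans (σ-cong row₀) σ-0)
            row₂ : polar A B C D E z₂ z₀ z₁ (σ (σ ε)) ε (σ ε) ≈ 0#
            row₂ = trans (sym (σ-polar (rotate z) (rotate ε⃗))) (trans (σ-cong row₁) σ-0)
            h⃗ = orbit-adjoint ε⃗
            h≉0 = adjoint-nonvanishing ε ε≉0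
            det≉0 : dicksonDet A B C D E ε (σ ε) (σ (σ ε)) ≉ 0#
            det≉0 det≈0 = 2×x≉0 (2×x≉0 (x≉0∧y≉0⇒xy≉0 (x≉0∧y≉0⇒xy≉0 h≉0 (orbit-≉0 h⃗ h≉0))
                                                    (orbit-≉0 (rotate h⃗) (orbit-≉0 h⃗ h≉0))))
              (trans (sym (dicksonDet≈2×2×norm ε (σ ε) (σ (σ ε)) eqα eqβ eqγ eqδ)) det≈0)

          quadratic-cong : ∀ {u₀ u₁ u₂ v₀ v₁ v₂} → u₀ ≈ v₀ → u₁ ≈ v₁ → u₂ ≈ v₂ →
                           quadratic A B C D E u₀ u₁ u₂ ≈ quadratic A B C D E v₀ v₁ v₂
          quadratic-cong u₀≈v₀ u₁≈v₁ u₂≈v₂ = ⟦⟧-cong (close 8 Poly.quadratic)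
            (refl ∷ refl ∷ refl ∷ refl ∷ refl ∷ u₀≈v₀ ∷ u₁≈v₁ ∷ u₂≈v₂ ∷ [])

          f-cong : Congruent _≈_ _≈_ f
          f-cong x≈y = quadratic-cong x≈y (σ-cong x≈y) (σ-cong (σ-cong x≈y))

          Δ : Carrier → Carrier → Carrier
          Δ ε x = f (x + ε) - f x

          Δ-injective : ∀ {ε} → ε ≉ 0# → Injective _≈_ _≈_ (Δ ε)
          Δ-injective {ε} ε≉0 {x} {y} Δx≈Δy = x∙y⁻¹≈ε⇒x≈y x y
            (polar-kernel ε≉0 (orbit-difference (orbit x) (orbit y)) (begin
              polar A B C D E (x - y) (σ x - σ y) (σ (σ x) - σ (σ y)) ε (σ ε) (σ (σ ε))
                ≈⟨ quadratic-difference A B C D E x (σ x) (σ (σ x)) y (σ y) (σ (σ y)) ε (σ ε) (σ (σ ε)) ⟨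
              (Q (x + ε) (σ x + σ ε) (σ (σ x) + σ (σ ε)) - f x)
              - (Q (y + ε) (σ y + σ ε) (σ (σ y) + σ (σ ε)) - f y)
                ≈⟨ +-cong (+-congʳ (f-+ x)) (-‿cong (+-congʳ (f-+ y))) ⟨
              Δ ε x - Δ ε y
                ≈⟨ x≈y⇒x∙y⁻¹≈ε Δx≈Δy ⟩
              0# ∎))
            where
            Q = quadratic A B C D E
            f-+ : ∀ x → f (x + ε) ≈ Q (x + ε) (σ x + σ ε) (σ (σ x) + σ (σ ε))
            f-+ x = quadratic-cong refl (σ-+ x ε) (trans (σ-cong (σ-+ x ε)) (σ-+ (σ x) (σ ε)))

          planar : Planar K f
          planar ε ε≉0 = Δ-injective ε≉0 , injective⇒surjective Δ-cong (Δ-injective ε≉0)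
            where
            Δ-cong : Congruent _≈_ _≈_ (Δ ε)
            Δ-cong x≈y = +-cong (f-cong (+-congʳ x≈y)) (-‿cong (f-cong x≈y))

module CubicFrobenius {c ℓ} (K : Field c ℓ) (p k : ℕ) (p-prime : Prime p)
  (enumeration : Bijection (≡-setoid (Fin ((p ^ℕ suc k) ^ℕ 3))) (Field.setoid K)) where
  open Field K
  open FieldProperties K using (x≉0∧y≉0⇒xy≉0)
  open MonicPolynomials K using (monic; trinomial; length-trinomial; monic-trinomial)
  open FiniteField K enumeration
  open import Algebra.Properties.Semiring.Mult semiring using (×1-homo-*)
  open import Algebra.Properties.Semiring.Exp semiring using (^-congˡ; ^-congʳ; ^-assocʳ)
  open import Algebra.Properties.Semiring.Exp semiring using (^-homo-*)
  open RingMorphisms rawRing rawRing using (IsRingHomomorphism)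
  open DicksonForms rawRing using (quadratic)
  open import Relation.Binary.Reasoning.Setoid setoid

  q : ℕ
  q = p ^ℕ suc k

  1<q : 1 ℕ.< q
  1<q = ℕ.^-monoʳ-< p (ℕ.nonTrivial⇒n>1 p {{prime⇒nonTrivial p-prime}}) {0} {suc k} (ℕ.s≤s ℕ.z≤n)

  p×1≈0 : p × 1# ≈ 0#
  p×1≈0 = x^n≈0⇒x≈0 (suc k) (x^n≈0⇒x≈0 3 (begin
    ((p × 1#) ^ suc k) ^ 3 ≈⟨ ^-congˡ 3 (×1-homo-^ p (suc k)) ⟨
    (q × 1#) ^ 3           ≈⟨ ×1-homo-^ q 3 ⟨
    (q ^ℕ 3) × 1#          ≈⟨ N×1≈0 ⟩
    0#                     ∎))
    where
    ×1-homo-^ : ∀ m n → (m ^ℕ n) × 1# ≈ (m × 1#) ^ n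
    ×1-homo-^ m zero    = +-identityʳ 1#
    ×1-homo-^ m (suc n) = trans (×1-homo-* m (m ^ℕ n)) (*-congˡ (×1-homo-^ m n))

  open Characteristic commutativeRing p-prime p×1≈0 using (^p^n-isRingHomomorphism; odd⇒2×1≈0⇒1≈0)

  frobenius : Carrier → Carrier
  frobenius x = x ^ q

  frobenius-isRingHomomorphism : IsRingHomomorphism frobenius
  frobenius-isRingHomomorphism = ^p^n-isRingHomomorphism (suc k)

  2×1≉0 : p ≢ 2 → 2 × 1# ≉ 0#
  2×1≉0 p≢2 2×1≈0 = 1≉0 (odd⇒2×1≈0⇒1≈0 p≢2 2×1≈0)

  frobenius² : ∀ x → frobenius (frobenius x) ≈ x ^ (q ℕ.* q)
  frobenius² x = ^-assocʳ x q q

  x^[q²]≈frobenius² : ∀ x → x ^ (q ^ℕ 2) ≈ frobenius (frobenius x)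
  x^[q²]≈frobenius² x = trans (^-congʳ x (≡.cong (q ℕ.*_) (ℕ.*-identityʳ q))) (sym (frobenius² x))

  frobenius³≈id : ∀ x → frobenius (frobenius (frobenius x)) ≈ x
  frobenius³≈id x = begin
    ((x ^ q) ^ q) ^ q   ≈⟨ ^-congˡ q (frobenius² x) ⟩
    (x ^ (q ℕ.* q)) ^ q ≈⟨ ^-assocʳ x (q ℕ.* q) q ⟩
    x ^ (q ℕ.* q ℕ.* q) ≡⟨ ≡.cong (x ^_) q*q*q≡q³ ⟩
    x ^ (q ^ℕ 3)        ≈⟨ x^N≈x x ⟩
    x                   ∎
    where
    q*q*q≡q³ : q ℕ.* q ℕ.* q ≡ q ^ℕ 3
    q*q*q≡q³ = ≡.trans (ℕ.*-assoc q q q) (≡.cong (λ t → q ℕ.* (q ℕ.* t)) (≡.sym (ℕ.*-identityʳ q)))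

  trace-nonvanishing : ¬ (∀ t → t + frobenius t + frobenius (frobenius t) ≈ 0#)
  trace-nonvanishing trace≈0 = monic-nonvanishing (trinomial m n) degree<q³ λ t → begin
      monic (trinomial m n) t                          ≈⟨ monic-trinomial m n t ⟩
      t + t ^ (2 ℕ.+ m) + t ^ (2 ℕ.+ m ℕ.+ suc n)
        ≡⟨ ≡.cong₂ (λ i j → t + t ^ i + t ^ j) 2+m≡q 2+m+1+n≡q*q ⟩
      t + t ^ q + t ^ (q ℕ.* q)                        ≈⟨ +-congˡ (frobenius² t) ⟨
      t + frobenius t + frobenius (frobenius t)        ≈⟨ trace≈0 t ⟩
      0#                                               ∎
    where
    m = q ℕ.∸ 2
    n = q ℕ.* q ℕ.∸ suc q
    2+m≡q : 2 ℕ.+ m ≡ q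
    2+m≡q = ℕ.m+[n∸m]≡n 1<q
    2+m+1+n≡q*q : 2 ℕ.+ m ℕ.+ suc n ≡ q ℕ.* q
    2+m+1+n≡q*q = ≡.trans (≡.cong (ℕ._+ suc n) 2+m≡q) (≡.trans (ℕ.+-suc q n) (ℕ.m+[n∸m]≡n 1+q≤q*q))
      where
      1+q≤q*q : suc q ℕ.≤ q ℕ.* q
      1+q≤q*q = ℕ.≤-trans (ℕ.+-monoˡ-≤ q (ℕ.<⇒≤ 1<q))
        (ℕ.≤-trans (ℕ.≤-reflexive (≡.cong (q ℕ.+_) (≡.sym (ℕ.+-identityʳ q)))) (ℕ.*-monoˡ-≤ q 1<q))
    degree<q³ : length (trinomial m n) ℕ.< q ^ℕ 3
    degree<q³ = ≡.subst (ℕ._< q ^ℕ 3)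
      (≡.trans (≡.cong (q ℕ.*_) (ℕ.*-identityʳ q)) (≡.sym (≡.trans (length-trinomial m n) 2+m+1+n≡q*q)))
      (ℕ.^-monoʳ-< q 1<q (ℕ.n<1+n 2))

  quadratic-frobenius : ∀ A B C D E X →
    E * X ^ 2 + A * X ^ (q +ℕ 1) + B * X ^ (q ^ℕ 2 +ℕ 1) + C * X ^ (2 ℕ.* q) + D * X ^ (2 ℕ.* (q ^ℕ 2))
    ≈ quadratic A B C D E X (frobenius X) (frobenius (frobenius X))
  quadratic-frobenius A B C D E X =
    +-cong (+-cong (+-cong (+-cong (*-congˡ (*-congˡ (*-identityʳ X)))
                                   (*-congˡ (x^[m+1]≈x^m*x q)))
                           (*-congˡ (trans (x^[m+1]≈x^m*x (q ^ℕ 2)) (*-congʳ (x^[q²]≈frobenius² X)))))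
                   (*-congˡ (x^[2m]≈x^m*x^m q)))
           (*-congˡ (trans (x^[2m]≈x^m*x^m (q ^ℕ 2)) (*-cong (x^[q²]≈frobenius² X) (x^[q²]≈frobenius² X))))
    where
    x^[m+1]≈x^m*x : ∀ m → X ^ (m +ℕ 1) ≈ X ^ m * X
    x^[m+1]≈x^m*x m = trans (^-homo-* X m 1) (*-congˡ (*-identityʳ X))
    x^[2m]≈x^m*x^m : ∀ m → X ^ (2 ℕ.* m) ≈ X ^ m * X ^ m
    x^[2m]≈x^m*x^m m =
      trans (^-congʳ X (ℕ.*-comm 2 m)) (trans (sym (^-assocʳ X m 2)) (*-congˡ (*-identityʳ _)))

corollary2p6 : ∀ {ℓ₁ ℓ₂ : Level} (K : Field ℓ₁ ℓ₂) (p k : ℕ) → Prime p → p ≢ 2 →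
  let q = p ^ℕ suc k
      open Field K
  in Bijection (≡-setoid (Fin (q ^ℕ 3))) (Field.setoid K) →
  (a b c : Carrier) → InSubfield K q a → InSubfield K q b → InSubfield K q c →
  (∀ x → ¬ (x ≈ 0#) → ¬ ((a * x ^ (q ^ℕ 2) + b * x ^ q + c * x) ≈ 0#)) →
  let α = a * b * c
      β = a * a * b + a * c * c + b * b * c
      γ = a * a * c + a * b * b + b * c * c
      δ = a * a * a + b * b * b + c * c * c + 3 × (a * b * c)
  in (A B C D E : Carrier) →
  InSubfield K q A → InSubfield K q B → InSubfield K q C →
  InSubfield K q D → InSubfield K q E →
  (- (A * A * D) + A * B * E - B * B * C) ≈ 2 × α →
  (A * A * C - A * B * D - 2 × (A * C * D) + 2 × (A * E * E) + B * B * E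
    - 2 × (B * C * E) + 2 × (B * D * D)) ≈ 2 × β →
  (A * A * E - A * B * C + 2 × (A * C * C) - 2 × (A * D * E) + B * B * D
    - 2 × (B * C * D) + 2 × (B * E * E)) ≈ 2 × γ →
  (A * A * A + B * B * B + 4 × (C * C * C) - 12 × (C * D * E)
    + 4 × (D * D * D) + 4 × (E * E * E)) ≈ 2 × δ →
  Planar K (λ X → E * X ^ 2 + A * X ^ (q +ℕ 1) + B * X ^ (q ^ℕ 2 +ℕ 1)
                  + C * X ^ (2 Data.Nat.* q) + D * X ^ (2 Data.Nat.* (q ^ℕ 2)))
corollary2p6 K p k p-prime p≢2 enumeration a b c a-fixed b-fixed c-fixed no-roots
             A B C D E A-fixed B-fixed C-fixed D-fixed E-fixed eqα eqβ eqγ eqδ =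
  Planar-cong (λ X → sym (quadratic-frobenius A B C D E X))
    (planar a-fixed b-fixed c-fixed g-nonvanishing
            A-fixed B-fixed C-fixed D-fixed E-fixed eqα eqβ eqγ eqδ)
  where
  open Field K
  open FieldProperties K using (Planar-cong)
  open CubicFrobenius K p k p-prime enumeration
  open CyclicCubicExtension K enumeration frobenius frobenius-isRingHomomorphism frobenius³≈id
                            (2×1≉0 p≢2) trace-nonvanishing
  g-nonvanishing : ∀ x → x ≉ 0# → g a-fixed b-fixed c-fixed x ≉ 0#
  g-nonvanishing x x≉0 gx≈0 =
    no-roots x x≉0 (trans (+-congʳ (+-congʳ (*-congˡ (x^[q²]≈frobenius² x)))) gx≈0)
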